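{- Let $G=(V,E,s_0,s_1)$ be a switch graph with $n=|V|$. The associated one-step update $f:\mathbb{R}^n_{\ge0}\to\mathbb{R}^n_{\ge0}$ is monotone with respect to the coordinate-wise partial order and non-expansive with respect to the $\ell_1$-norm, i.e. $\|f(x)-f(y)\|_1\le\|x-y\|_1$ for all $x,y\in\mathbb{R}^n_{\ge0}$.
   Context: A switch graph is a directed multigraph $G=(V,E,s_0,s_1)$ with $s_0,s_1:V\to V$ and $E=\{(v,s_0(v))\}\cup\{(v,s_1(v))\}$ (multiset). Define $h_0,h_1:\mathbb{R}_{\ge0}\to\mathbb{R}_{\ge0}$ by $h_0(x)=\min\{x-\lfloor x/2\rfloor,\lceil x/2\rceil\}$ and $h_1(x)=\max\{\lfloor x/2\rfloor,x-\lceil x/2\rceil\}$. The one-step update is $f(x)_v=\sum_{u:s_0(u)=v}h_0(x_u)+\sum_{u:s_1(u)=v}h_1(x_u)$ for $v\in V$. $f$ is monotone if $x\le y$ coordinate-wise implies $f(x)\le f(y)$. -}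

module Defs where

open import Level using (0ℓ)
open import Data.Nat using (ℕ; zero; suc)
open import Data.Integer using (ℤ; +_; -[1+_])
open import Data.Fin using (Fin; zero; suc; _≟_)
open import Data.Product using (Σ; ∃; _×_; _,_)
open import Relation.Nullary using (¬_; yes; no)
open import Relation.Binary.PropositionalEquality using (_≡_)
open import Algebra.Structures using (IsCommutativeRing)
open import Relation.Binary.Structures using (IsDecTotalOrder)

embℕ : {A : Set} → A → A → (A → A → A) → ℕ → A
embℕ z o p zero = z
embℕ z o p (suc n) = p o (embℕ z o p n)

embℤ : {A : Set} → A → A → (A → A → A) → (A → A) → ℤ → A
embℤ z o p m (+ n) = embℕ z o p n
embℤ z o p m -[1+ n ] = m (embℕ z o p (suc n))

-- The real numbers, axiomatised as a complete ordered field
-- (unique up to isomorphism).  Floor, a multiplicative inverse function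
-- and decidability of ≤ are included as data; they exist (classically)
-- and are uniquely determined in ℝ.
record RealField : Set₁ where
  infixl 6 _+_ _-_
  infixl 7 _*_
  infix 4 _≤_ _<_
  field
    R     : Set
    _+_   : R → R → R
    _*_   : R → R → R
    -_    : R → R
    0#    : R
    1#    : R
    _≤_   : R → R → Set
    isCommutativeRing : IsCommutativeRing _≡_ _+_ _*_ -_ 0# 1#
    isDecTotalOrder   : IsDecTotalOrder _≡_ _≤_
    0≢1   : ¬ (0# ≡ 1#)
    +-monoˡ-≤ : ∀ {x y} z → x ≤ y → x + z ≤ y + z
    *-nonneg  : ∀ {x y} → 0# ≤ x → 0# ≤ y → 0# ≤ x * y
    inv   : R → R
    inv-spec : ∀ x → ¬ (x ≡ 0#) → x * inv x ≡ 1#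
    complete : (S : R → Set) → (∃ λ s → S s) →
               (∃ λ b → ∀ s → S s → s ≤ b) →
               ∃ λ u → (∀ s → S s → s ≤ u) × (∀ b → (∀ s → S s → s ≤ b) → u ≤ b)
  _-_ : R → R → R
  x - y = x + (- y)
  _<_ : R → R → Set
  x < y = (x ≤ y) × ¬ (x ≡ y)
  fromℤ : ℤ → R
  fromℤ = embℤ 0# 1# _+_ (λ a → - a)
  field
    ⌊_⌋ : R → ℤ
    floor-spec : ∀ x → (fromℤ ⌊ x ⌋ ≤ x) × (x < fromℤ ⌊ x ⌋ + 1#)

module RealOps (ℝ : RealField) where
  open RealField ℝ public
  open IsDecTotalOrder isDecTotalOrder using (_≤?_)

  ⌈_⌉ : R → ℤ
  ⌈ x ⌉ = Data.Integer.-_ ⌊ - x ⌋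

  half : R → R
  half x = x * inv (1# + 1#)

  min max : R → R → R
  min x y with x ≤? y
  ... | yes _ = x
  ... | no _  = y
  max x y with x ≤? y
  ... | yes _ = y
  ... | no _  = x

  ∣_∣ : R → R
  ∣ x ∣ = max x (- x)

  Σ[_] : ∀ {n} → (Fin n → R) → R
  Σ[_] {zero} g = 0#
  Σ[_] {suc n} g = g zero + Σ[_] (λ i → g (suc i))

  h₀ h₁ : R → R
  h₀ x = min (x - fromℤ ⌊ half x ⌋) (fromℤ ⌈ half x ⌉)
  h₁ x = max (fromℤ ⌊ half x ⌋) (x - fromℤ ⌈ half x ⌉)

  when : ∀ {n} → Fin n → Fin n → R → R
  when a b r with a ≟ b
  ... | yes _ = r
  ... | no _  = 0#

  f : ∀ {n} → (s₀ s₁ : Fin n → Fin n) → (Fin n → R) → Fin n → R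
  f s₀ s₁ x v = Σ[ (λ u → when (s₀ u) v (h₀ (x u))) ] + Σ[ (λ u → when (s₁ u) v (h₁ (x u))) ]

  Nonneg : ∀ {n} → (Fin n → R) → Set
  Nonneg x = ∀ v → 0# ≤ x v

  _≤ᵛ_ : ∀ {n} → (Fin n → R) → (Fin n → R) → Set
  x ≤ᵛ y = ∀ v → x v ≤ y v

  ‖_‖₁ : ∀ {n} → (Fin n → R) → R
  ‖ x ‖₁ = Σ[ (λ v → ∣ x v ∣) ]

  _-ᵛ_ : ∀ {n} → (Fin n → R) → (Fin n → R) → Fin n → R
  (x -ᵛ y) v = x v - y v

-- For integer j put split₀ j x = min (x - j) (j + 1) and split₁ j x = max j (x - (j + 1)); these are
-- monotone in x and sum to x.  With k = ⌊x/2⌋ one has h₀ x = split₀ k x, and this is the largest of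
-- all split₀ j x, while h₁ x = x - h₀ x is the smallest of all split₁ j x.  Hence h₀ and h₁ are
-- monotone, being a pointwise supremum (resp. infimum) of monotone functions.  Two monotone functions
-- summing to the identity split every distance exactly, |x - y| = |h₀ x - h₀ y| + |h₁ x - h₁ y|, and
-- moving mass along the maps s₀, s₁ cannot increase the ℓ₁-norm, which gives non-expansiveness.
module Submission where

open import Defs
open import Level using (0ℓ)
open import Data.Nat as ℕ using (ℕ; z≤n; s≤s)
open import Data.Integer as ℤ using (ℤ; -[1+_])
import Data.Integer.Properties as ℤ
open import Data.Fin using (Fin; zero; suc; _≟_)
open import Data.Product using (_×_; _,_; proj₁; proj₂)
open import Data.Sum using (_⊎_; inj₁; inj₂)
open import Function using (_∘_)
open import Relation.Nullary using (¬_; yes; no; contradiction)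
open import Relation.Binary.Definitions using (tri<; tri≈; tri>)
open import Relation.Binary.PropositionalEquality
  using (_≡_; _≢_; refl; sym; trans; cong; cong₂; subst; subst₂; module ≡-Reasoning)
open import Relation.Binary.Bundles using (DecTotalOrder)
open import Algebra.Bundles using (CommutativeRing)
open import Algebra.Construct.NaturalChoice.Base using (MinOperator; MaxOperator)
import Algebra.Construct.NaturalChoice.MinMaxOp as MinMaxOp
import Relation.Binary.Reasoning.PartialOrder as PartialOrderReasoning
import Algebra.Properties.AbelianGroup as AbelianGroupProperties
import Algebra.Properties.CommutativeSemigroup as CommutativeSemigroupProperties
import Algebra.Properties.Ring as RingProperties

module SwitchGraphUpdate (ℝ : RealField) where
  open RealOps ℝ

  private variable
    m n : ℕ

  commutativeRing : CommutativeRing 0ℓ 0ℓ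
  commutativeRing = record { isCommutativeRing = isCommutativeRing }

  decTotalOrder : DecTotalOrder 0ℓ 0ℓ 0ℓ
  decTotalOrder = record { isDecTotalOrder = isDecTotalOrder }

  open CommutativeRing commutativeRing
    using (+-comm; +-identityˡ; +-identityʳ; -‿inverseʳ; *-identityˡ; *-identityʳ; distribˡ; distribʳ)
  open DecTotalOrder decTotalOrder using (total; antisym; _≤?_; totalPreorder; poset)
    renaming (refl to ≤-refl; reflexive to ≤-reflexive; trans to ≤-trans)
  open AbelianGroupProperties (CommutativeRing.+-abelianGroup commutativeRing)
    using (⁻¹-∙-comm; ⁻¹-anti-homo-∙; //-rightDividesˡ; //-rightDividesʳ; \\-leftDividesˡ)
    renaming (⁻¹-involutive to -‿involutive; ε⁻¹≈ε to -0≡0; ⁻¹-anti-homo‿- to -[x-y]≡y-x)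
  open CommutativeSemigroupProperties (CommutativeRing.+-commutativeSemigroup commutativeRing)
    using (interchange)
  open RingProperties (CommutativeRing.ring commutativeRing) using (-1*x≈-x)
  module ≤-Reasoning = PartialOrderReasoning poset

  x+y-y≡x : ∀ x y → (x + y) - y ≡ x
  x+y-y≡x x y = //-rightDividesʳ y x

  x-y+y≡x : ∀ x y → (x - y) + y ≡ x
  x-y+y≡x x y = //-rightDividesˡ y x

  x+[y-x]≡y : ∀ x y → x + (y - x) ≡ y
  x+[y-x]≡y x y = trans (+-comm x (y - x)) (x-y+y≡x y x)

  x-[x-y]≡y : ∀ x y → x - (x - y) ≡ y
  x-[x-y]≡y x y = trans (cong (x +_) (-[x-y]≡y-x x y)) (x+[y-x]≡y x y)

  x-0≡x : ∀ x → x - 0# ≡ x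
  x-0≡x x = trans (cong (x +_) -0≡0) (+-identityʳ x)

  -[1+x]+1≡-x : ∀ x → - (1# + x) + 1# ≡ - x
  -[1+x]+1≡-x x = trans (cong (_+ 1#) (⁻¹-anti-homo-∙ 1# x)) (x-y+y≡x (- x) 1#)

  [a-c]+[b-d]≡[a+b]-[c+d] : ∀ a b c d → (a - c) + (b - d) ≡ (a + b) - (c + d)
  [a-c]+[b-d]≡[a+b]-[c+d] a b c d = trans (interchange a (- c) b (- d)) (cong (a + b +_) (⁻¹-∙-comm c d))

  -‿distrib-+ : ∀ x y → - (x + y) ≡ - x + - y
  -‿distrib-+ x y = sym (⁻¹-∙-comm x y)

  +-monoʳ-≤ : ∀ z {x y} → x ≤ y → z + x ≤ z + y
  +-monoʳ-≤ z {x} {y} x≤y = subst₂ _≤_ (+-comm x z) (+-comm y z) (+-monoˡ-≤ z x≤y)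

  +-mono-≤ : ∀ {a b c d} → a ≤ b → c ≤ d → a + c ≤ b + d
  +-mono-≤ {b = b} {c} a≤b c≤d = ≤-trans (+-monoˡ-≤ c a≤b) (+-monoʳ-≤ b c≤d)

  +-cancelʳ-≤ : ∀ z {x y} → x + z ≤ y + z → x ≤ y
  +-cancelʳ-≤ z {x} {y} p = subst₂ _≤_ (x+y-y≡x x z) (x+y-y≡x y z) (+-monoˡ-≤ (- z) p)

  neg-mono-≤ : ∀ {x y} → x ≤ y → - y ≤ - x
  neg-mono-≤ {x} {y} x≤y = subst₂ _≤_ (\\-leftDividesˡ x (- y)) y+[-x-y]≡-x (+-monoˡ-≤ (- x + - y) x≤y)
    where
    y+[-x-y]≡-x : y + (- x + - y) ≡ - x
    y+[-x-y]≡-x = trans (cong (y +_) (+-comm (- x) (- y))) (\\-leftDividesˡ y (- x))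

  sub-antimono-≤ : ∀ z {x y} → x ≤ y → z - y ≤ z - x
  sub-antimono-≤ z x≤y = +-monoʳ-≤ z (neg-mono-≤ x≤y)

  x≤y⇒x-y≤0 : ∀ {x y} → x ≤ y → x - y ≤ 0#
  x≤y⇒x-y≤0 {x} {y} x≤y = subst (x - y ≤_) (-‿inverseʳ y) (+-monoˡ-≤ (- y) x≤y)

  0≤x⇒-x≤0 : ∀ {x} → 0# ≤ x → - x ≤ 0#
  0≤x⇒-x≤0 {x} 0≤x = subst (- x ≤_) -0≡0 (neg-mono-≤ 0≤x)

  x≤0⇒0≤-x : ∀ {x} → x ≤ 0# → 0# ≤ - x
  x≤0⇒0≤-x {x} x≤0 = subst (_≤ - x) -0≡0 (neg-mono-≤ x≤0)

  0≤1 : 0# ≤ 1#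
  0≤1 with total 0# 1#
  ... | inj₁ 0≤1 = 0≤1
  ... | inj₂ 1≤0 = subst (0# ≤_) -1*-1≡1 (*-nonneg 0≤-1 0≤-1)
    where
    0≤-1 : 0# ≤ - 1#
    0≤-1 = x≤0⇒0≤-x 1≤0
    -1*-1≡1 : - 1# * - 1# ≡ 1#
    -1*-1≡1 = trans (-1*x≈-x (- 1#)) (-‿involutive 1#)

  x≤x+1 : ∀ x → x ≤ x + 1#
  x≤x+1 x = subst (_≤ x + 1#) (+-identityʳ x) (+-monoʳ-≤ x 0≤1)

  x+1≰x : ∀ x → ¬ (x + 1# ≤ x)
  x+1≰x x x+1≤x = 0≢1 (antisym 0≤1 1≤0)
    where
    1≤0 : 1# ≤ 0#
    1≤0 = +-cancelʳ-≤ x (subst₂ _≤_ (+-comm x 1#) (sym (+-identityˡ x)) x+1≤x)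

  <⇒≱ : ∀ {x y} → x < y → ¬ (y ≤ x)
  <⇒≱ (x≤y , x≢y) y≤x = x≢y (antisym x≤y y≤x)

  min-≤ : ∀ {x y} → x ≤ y → min x y ≡ x
  min-≤ {x} {y} x≤y with x ≤? y
  ... | yes _   = refl
  ... | no  x≰y = contradiction x≤y x≰y

  min-≥ : ∀ {x y} → y ≤ x → min x y ≡ y
  min-≥ {x} {y} y≤x with x ≤? y
  ... | yes x≤y = antisym x≤y y≤x
  ... | no  _   = refl

  max-≤ : ∀ {x y} → x ≤ y → max x y ≡ y
  max-≤ {x} {y} x≤y with x ≤? y
  ... | yes _   = refl
  ... | no  x≰y = contradiction x≤y x≰y

  max-≥ : ∀ {x y} → y ≤ x → max x y ≡ x
  max-≥ {x} {y} y≤x with x ≤? y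
  ... | yes x≤y = antisym y≤x x≤y
  ... | no  _   = refl

  minOperator : MinOperator totalPreorder
  minOperator = record { _⊓_ = min ; x≤y⇒x⊓y≈x = min-≤ ; x≥y⇒x⊓y≈y = min-≥ }

  maxOperator : MaxOperator totalPreorder
  maxOperator = record { _⊔_ = max ; x≤y⇒x⊔y≈y = max-≤ ; x≥y⇒x⊔y≈x = max-≥ }

  open MinMaxOp minOperator maxOperator
    using (x⊓y≤x; x⊓y≤y; ⊓-glb; ⊓-monoˡ-≤; x≤x⊔y; x≤y⊔x; ⊔-lub; ⊔-monoʳ-≤; ⊔-comm; antimono-≤-distrib-⊓)

  max-complement : ∀ x a b → max a (x - b) ≡ x - min (x - a) b
  max-complement x a b = begin
    max a (x - b)              ≡⟨ cong (λ t → max t (x - b)) (x-[x-y]≡y x a) ⟨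
    max (x - (x - a)) (x - b)  ≡⟨ antimono-≤-distrib-⊓ (cong (_-_ x)) (sub-antimono-≤ x) (x - a) b ⟨
    x - min (x - a) b          ∎
    where open ≡-Reasoning

  ∣x∣≡x : ∀ {x} → 0# ≤ x → ∣ x ∣ ≡ x
  ∣x∣≡x {x} 0≤x = max-≥ (≤-trans (0≤x⇒-x≤0 0≤x) 0≤x)

  ∣x∣≡-x : ∀ {x} → x ≤ 0# → ∣ x ∣ ≡ - x
  ∣x∣≡-x {x} x≤0 = max-≤ (≤-trans x≤0 (x≤0⇒0≤-x x≤0))

  ∣0∣≡0 : ∣ 0# ∣ ≡ 0#
  ∣0∣≡0 = ∣x∣≡x ≤-refl

  ∣x-y∣≡∣y-x∣ : ∀ x y → ∣ x - y ∣ ≡ ∣ y - x ∣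
  ∣x-y∣≡∣y-x∣ x y = begin
    max (x - y) (- (x - y))  ≡⟨ cong (max (x - y)) (-[x-y]≡y-x x y) ⟩
    max (x - y) (y - x)      ≡⟨ ⊔-comm (x - y) (y - x) ⟩
    max (y - x) (x - y)      ≡⟨ cong (max (y - x)) (-[x-y]≡y-x y x) ⟨
    max (y - x) (- (y - x))  ∎
    where open ≡-Reasoning

  ∣x+y∣≤∣x∣+∣y∣ : ∀ x y → ∣ x + y ∣ ≤ ∣ x ∣ + ∣ y ∣
  ∣x+y∣≤∣x∣+∣y∣ x y = ⊔-lub (+-mono-≤ (x≤x⊔y x (- x)) (x≤x⊔y y (- y)))
    (subst (_≤ ∣ x ∣ + ∣ y ∣) (sym (-‿distrib-+ x y)) (+-mono-≤ (x≤y⊔x x (- x)) (x≤y⊔x y (- y))))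

  ∣a-c∣+∣b-d∣≡∣[a+b]-[c+d]∣ : ∀ {a b c d} → a ≤ c → b ≤ d →
                              ∣ a - c ∣ + ∣ b - d ∣ ≡ ∣ (a + b) - (c + d) ∣
  ∣a-c∣+∣b-d∣≡∣[a+b]-[c+d]∣ {a} {b} {c} {d} a≤c b≤d = begin
    ∣ a - c ∣ + ∣ b - d ∣    ≡⟨ cong₂ _+_ (∣x∣≡-x (x≤y⇒x-y≤0 a≤c)) (∣x∣≡-x (x≤y⇒x-y≤0 b≤d)) ⟩
    - (a - c) + - (b - d)  ≡⟨ ⁻¹-∙-comm (a - c) (b - d) ⟩
    - ((a - c) + (b - d))  ≡⟨ cong -_ ([a-c]+[b-d]≡[a+b]-[c+d] a b c d) ⟩
    - ((a + b) - (c + d))  ≡⟨ ∣x∣≡-x (x≤y⇒x-y≤0 (+-mono-≤ a≤c b≤d)) ⟨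
    ∣ (a + b) - (c + d) ∣  ∎
    where open ≡-Reasoning

  Monotone : (R → R) → Set
  Monotone φ = ∀ {x y} → x ≤ y → φ x ≤ φ y

  module _ {φ₀ φ₁ : R → R} (φ₀-mono : Monotone φ₀) (φ₁-mono : Monotone φ₁)
           (φ₀+φ₁≡id : ∀ x → φ₀ x + φ₁ x ≡ x) where

    private
      splitting-preserves-∣-∣-≤ : ∀ {x y} → x ≤ y → ∣ φ₀ x - φ₀ y ∣ + ∣ φ₁ x - φ₁ y ∣ ≡ ∣ x - y ∣
      splitting-preserves-∣-∣-≤ {x} {y} x≤y =
        trans (∣a-c∣+∣b-d∣≡∣[a+b]-[c+d]∣ (φ₀-mono x≤y) (φ₁-mono x≤y))
              (cong₂ (λ a b → ∣ a - b ∣) (φ₀+φ₁≡id x) (φ₀+φ₁≡id y))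

    splitting-preserves-∣-∣ : ∀ x y → ∣ φ₀ x - φ₀ y ∣ + ∣ φ₁ x - φ₁ y ∣ ≡ ∣ x - y ∣
    splitting-preserves-∣-∣ x y with total x y
    ... | inj₁ x≤y = splitting-preserves-∣-∣-≤ x≤y
    ... | inj₂ y≤x = begin
      ∣ φ₀ x - φ₀ y ∣ + ∣ φ₁ x - φ₁ y ∣  ≡⟨ cong₂ _+_ (∣x-y∣≡∣y-x∣ (φ₀ x) (φ₀ y)) (∣x-y∣≡∣y-x∣ (φ₁ x) (φ₁ y)) ⟩
      ∣ φ₀ y - φ₀ x ∣ + ∣ φ₁ y - φ₁ x ∣  ≡⟨ splitting-preserves-∣-∣-≤ y≤x ⟩
      ∣ y - x ∣                          ≡⟨ ∣x-y∣≡∣y-x∣ x y ⟨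
      ∣ x - y ∣                          ∎
      where open ≡-Reasoning

  -- Integers, floor and ceiling

  0≤fromℤ+ : ∀ n → 0# ≤ fromℤ (ℤ.+ n)
  0≤fromℤ+ ℕ.zero    = ≤-refl
  0≤fromℤ+ (ℕ.suc n) = ≤-trans 0≤1 (subst (_≤ 1# + fromℤ (ℤ.+ n)) (+-identityʳ 1#) (+-monoʳ-≤ 1# (0≤fromℤ+ n)))

  fromℤ+-mono-≤ : ∀ {m n} → m ℕ.≤ n → fromℤ (ℤ.+ m) ≤ fromℤ (ℤ.+ n)
  fromℤ+-mono-≤ {n = n} z≤n = 0≤fromℤ+ n
  fromℤ+-mono-≤ (s≤s m≤n)   = +-monoʳ-≤ 1# (fromℤ+-mono-≤ m≤n)

  fromℤ-mono-≤ : ∀ {i j} → i ℤ.≤ j → fromℤ i ≤ fromℤ j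
  fromℤ-mono-≤ (ℤ.-≤- n≤m) = neg-mono-≤ (fromℤ+-mono-≤ (s≤s n≤m))
  fromℤ-mono-≤ (ℤ.-≤+ {m} {n}) =
    ≤-trans (0≤x⇒-x≤0 (0≤fromℤ+ (ℕ.suc m))) (0≤fromℤ+ n)
  fromℤ-mono-≤ (ℤ.+≤+ m≤n) = fromℤ+-mono-≤ m≤n

  fromℤ-suc : ∀ j → fromℤ (ℤ.suc j) ≡ fromℤ j + 1#
  fromℤ-suc (ℤ.+ n)           = +-comm 1# (fromℤ (ℤ.+ n))
  fromℤ-suc -[1+ ℕ.zero ]     = sym (trans (-[1+x]+1≡-x 0#) -0≡0)
  fromℤ-suc -[1+ ℕ.suc n ]    = sym (-[1+x]+1≡-x (fromℤ (ℤ.+ ℕ.suc n)))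

  fromℤ-neg : ∀ j → fromℤ (ℤ.- j) ≡ - fromℤ j
  fromℤ-neg (ℤ.+ ℕ.zero)  = sym -0≡0
  fromℤ-neg (ℤ.+ ℕ.suc n) = refl
  fromℤ-neg -[1+ n ]      = sym (-‿involutive _)

  fromℤ-<⇒+1≤ : ∀ {i j} → i ℤ.< j → fromℤ i + 1# ≤ fromℤ j
  fromℤ-<⇒+1≤ {i} {j} i<j = subst (_≤ fromℤ j) (fromℤ-suc i) (fromℤ-mono-≤ (ℤ.i<j⇒suc[i]≤j i<j))

  fromℤ-trichotomy : ∀ i j → fromℤ i + 1# ≤ fromℤ j ⊎ i ≡ j ⊎ fromℤ j + 1# ≤ fromℤ i
  fromℤ-trichotomy i j with ℤ.<-cmp i j
  ... | tri< i<j _ _ = inj₁ (fromℤ-<⇒+1≤ i<j)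
  ... | tri≈ _ i≡j _ = inj₂ (inj₁ i≡j)
  ... | tri> _ _ j<i = inj₂ (inj₂ (fromℤ-<⇒+1≤ j<i))

  fromℤ-sign : ∀ j → 0# ≤ fromℤ j ⊎ fromℤ j + 1# ≤ 0#
  fromℤ-sign (ℤ.+ n)  = inj₁ (0≤fromℤ+ n)
  fromℤ-sign -[1+ n ] = inj₂ (subst (_≤ 0#) (sym (-[1+x]+1≡-x (fromℤ (ℤ.+ n))))
                                    (0≤x⇒-x≤0 (0≤fromℤ+ n)))

  ⌊x⌋≤x : ∀ x → fromℤ ⌊ x ⌋ ≤ x
  ⌊x⌋≤x x = proj₁ (floor-spec x)

  x<⌊x⌋+1 : ∀ x → x < fromℤ ⌊ x ⌋ + 1#
  x<⌊x⌋+1 x = proj₂ (floor-spec x)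

  x≤⌈x⌉ : ∀ x → x ≤ fromℤ ⌈ x ⌉
  x≤⌈x⌉ x = subst₂ _≤_ (-‿involutive x) (sym (fromℤ-neg ⌊ - x ⌋)) (neg-mono-≤ (⌊x⌋≤x (- x)))

  ⌈x⌉≤x+1 : ∀ x → fromℤ ⌈ x ⌉ ≤ x + 1#
  ⌈x⌉≤x+1 x = begin
    fromℤ ⌈ x ⌉          ≡⟨ fromℤ-neg ⌊ - x ⌋ ⟩
    - F                  ≡⟨ x-y+y≡x (- F) 1# ⟨
    (- F - 1#) + 1#      ≡⟨ cong (_+ 1#) (-‿distrib-+ F 1#) ⟨
    - (F + 1#) + 1#      ≤⟨ +-monoˡ-≤ 1# (neg-mono-≤ (proj₁ (x<⌊x⌋+1 (- x)))) ⟩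
    - (- x) + 1#         ≡⟨ cong (_+ 1#) (-‿involutive x) ⟩
    x + 1#               ∎
    where
    open ≤-Reasoning
    F = fromℤ ⌊ - x ⌋

  ⌈x⌉≡⌊x⌋+1⊎x∈ℤ : ∀ x → fromℤ ⌈ x ⌉ ≡ fromℤ ⌊ x ⌋ + 1# ⊎ (fromℤ ⌈ x ⌉ ≡ x × fromℤ ⌊ x ⌋ ≡ x)
  ⌈x⌉≡⌊x⌋+1⊎x∈ℤ x with fromℤ-trichotomy ⌈ x ⌉ (ℤ.suc ⌊ x ⌋)
  ... | inj₂ (inj₁ ⌈x⌉≡1+⌊x⌋) = inj₁ (trans (cong fromℤ ⌈x⌉≡1+⌊x⌋) (fromℤ-suc ⌊ x ⌋))
  ... | inj₂ (inj₂ ⌊x⌋+2≤⌈x⌉) = contradiction ⌊x⌋+1≤x (<⇒≱ (x<⌊x⌋+1 x))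
    where
    ⌊x⌋+1≤x : fromℤ ⌊ x ⌋ + 1# ≤ x
    ⌊x⌋+1≤x = +-cancelʳ-≤ 1# (≤-trans (subst (λ t → t + 1# ≤ fromℤ ⌈ x ⌉) (fromℤ-suc ⌊ x ⌋) ⌊x⌋+2≤⌈x⌉) (⌈x⌉≤x+1 x))
  ... | inj₁ ⌈x⌉+1≤⌊x⌋+1 = inj₂ (antisym (≤-trans ⌈x⌉≤⌊x⌋ (⌊x⌋≤x x)) (x≤⌈x⌉ x) ,
                                 antisym (⌊x⌋≤x x) (≤-trans (x≤⌈x⌉ x) ⌈x⌉≤⌊x⌋))
    where
    ⌈x⌉≤⌊x⌋ : fromℤ ⌈ x ⌉ ≤ fromℤ ⌊ x ⌋
    ⌈x⌉≤⌊x⌋ = +-cancelʳ-≤ 1# (subst (fromℤ ⌈ x ⌉ + 1# ≤_) (fromℤ-suc ⌊ x ⌋) ⌈x⌉+1≤⌊x⌋+1)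

  2≢0 : 1# + 1# ≢ 0#
  2≢0 2≡0 = x+1≰x 0# (subst (0# + 1# ≤_) 2≡0 (+-monoˡ-≤ 1# 0≤1))

  x/2+x/2≡x : ∀ x → half x + half x ≡ x
  x/2+x/2≡x x = begin
    x * ½ + x * ½          ≡⟨ distribˡ x ½ ½ ⟨
    x * (½ + ½)            ≡⟨ cong (x *_) (cong₂ _+_ (*-identityˡ ½) (*-identityˡ ½)) ⟨
    x * (1# * ½ + 1# * ½)  ≡⟨ cong (x *_) (distribʳ ½ 1# 1#) ⟨
    x * ((1# + 1#) * ½)    ≡⟨ cong (x *_) (inv-spec (1# + 1#) 2≢0) ⟩
    x * 1#                 ≡⟨ *-identityʳ x ⟩
    x                      ∎
    where
    open ≡-Reasoning
    ½ = inv (1# + 1#)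

  -- The maps h₀ and h₁

  a+a≤x⇒a≤x-a : ∀ {a x} → a + a ≤ x → a ≤ x - a
  a+a≤x⇒a≤x-a {a} {x} p = subst (_≤ x - a) (x+y-y≡x a a) (+-monoˡ-≤ (- a) p)

  x≤a+a⇒x-a≤a : ∀ {a x} → x ≤ a + a → x - a ≤ a
  x≤a+a⇒x-a≤a {a} {x} p = subst (x - a ≤_) (x+y-y≡x a a) (+-monoˡ-≤ (- a) p)

  ⌊_/2⌋ : R → ℤ
  ⌊ x /2⌋ = ⌊ half x ⌋

  2⌊x/2⌋≤x : ∀ x → fromℤ ⌊ x /2⌋ + fromℤ ⌊ x /2⌋ ≤ x
  2⌊x/2⌋≤x x = subst (fromℤ ⌊ x /2⌋ + fromℤ ⌊ x /2⌋ ≤_) (x/2+x/2≡x x)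
                      (+-mono-≤ (⌊x⌋≤x (half x)) (⌊x⌋≤x (half x)))

  x≤2⌊x/2⌋+2 : ∀ x → x ≤ (fromℤ ⌊ x /2⌋ + 1#) + (fromℤ ⌊ x /2⌋ + 1#)
  x≤2⌊x/2⌋+2 x = subst (_≤ (fromℤ ⌊ x /2⌋ + 1#) + (fromℤ ⌊ x /2⌋ + 1#)) (x/2+x/2≡x x)
                        (+-mono-≤ (proj₁ (x<⌊x⌋+1 (half x))) (proj₁ (x<⌊x⌋+1 (half x))))

  split₀ split₁ : R → R → R
  split₀ j x = min (x - j) (j + 1#)
  split₁ j x = max j (x - (j + 1#))

  split₀-mono : ∀ j → Monotone (split₀ j)
  split₀-mono j x≤y = ⊓-monoˡ-≤ (j + 1#) (+-monoˡ-≤ (- j) x≤y)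

  split₁-mono : ∀ j → Monotone (split₁ j)
  split₁-mono j x≤y = ⊔-monoʳ-≤ j (+-monoˡ-≤ (- (j + 1#)) x≤y)

  split₁≡x-split₀ : ∀ j x → split₁ j x ≡ x - split₀ j x
  split₁≡x-split₀ j x = max-complement x j (j + 1#)

  h₁≡x-h₀ : ∀ x → h₁ x ≡ x - h₀ x
  h₁≡x-h₀ x = max-complement x (fromℤ ⌊ x /2⌋) (fromℤ ⌈ half x ⌉)

  h₀+h₁≡id : ∀ x → h₀ x + h₁ x ≡ x
  h₀+h₁≡id x = trans (cong (h₀ x +_) (h₁≡x-h₀ x)) (x+[y-x]≡y (h₀ x) x)

  h₀≡split₀ : ∀ x → h₀ x ≡ split₀ (fromℤ ⌊ x /2⌋) x
  h₀≡split₀ x with ⌈x⌉≡⌊x⌋+1⊎x∈ℤ (half x)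
  ... | inj₁ ⌈x/2⌉≡⌊x/2⌋+1 = cong (min (x - F)) ⌈x/2⌉≡⌊x/2⌋+1
    where F = fromℤ ⌊ x /2⌋
  ... | inj₂ (⌈x/2⌉≡x/2 , ⌊x/2⌋≡x/2) = begin
    min (x - F) (fromℤ ⌈ half x ⌉)  ≡⟨ cong₂ min x-F≡F (trans ⌈x/2⌉≡x/2 (sym ⌊x/2⌋≡x/2)) ⟩
    min F F                        ≡⟨ min-≤ ≤-refl ⟩
    F                              ≡⟨ min-≤ (x≤x+1 F) ⟨
    min F (F + 1#)                 ≡⟨ cong (λ t → min t (F + 1#)) x-F≡F ⟨
    min (x - F) (F + 1#)           ∎
    where
    open ≡-Reasoning
    F = fromℤ ⌊ x /2⌋
    x-F≡F : x - F ≡ F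
    x-F≡F = begin
      x - F                  ≡⟨ cong (_- F) (x/2+x/2≡x x) ⟨
      (half x + half x) - F  ≡⟨ cong (λ t → (t + t) - F) ⌊x/2⌋≡x/2 ⟨
      (F + F) - F            ≡⟨ x+y-y≡x F F ⟩
      F                      ∎

  split₀≤h₀ : ∀ j x → split₀ (fromℤ j) x ≤ h₀ x
  split₀≤h₀ j x = subst (split₀ J x ≤_) (sym (h₀≡split₀ x)) (compare (fromℤ-trichotomy j ⌊ x /2⌋))
    where
    open ≤-Reasoning
    J = fromℤ j
    F = fromℤ ⌊ x /2⌋
    compare : J + 1# ≤ F ⊎ j ≡ ⌊ x /2⌋ ⊎ F + 1# ≤ J → split₀ J x ≤ split₀ F x
    compare (inj₁ J+1≤F) = begin
      split₀ J x  ≤⟨ x⊓y≤y (x - J) (J + 1#) ⟩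
      J + 1#      ≤⟨ J+1≤F ⟩
      F           ≤⟨ ⊓-glb (a+a≤x⇒a≤x-a (2⌊x/2⌋≤x x)) (x≤x+1 F) ⟩
      split₀ F x  ∎
    compare (inj₂ (inj₁ j≡⌊x/2⌋)) = ≤-reflexive (cong (λ i → split₀ (fromℤ i) x) j≡⌊x/2⌋)
    compare (inj₂ (inj₂ F+1≤J)) = begin
      split₀ J x   ≤⟨ x⊓y≤x (x - J) (J + 1#) ⟩
      x - J        ≤⟨ sub-antimono-≤ x F+1≤J ⟩
      x - (F + 1#) ≤⟨ ⊓-glb (sub-antimono-≤ x (x≤x+1 F)) (x≤a+a⇒x-a≤a (x≤2⌊x/2⌋+2 x)) ⟩
      split₀ F x   ∎

  h₁≤split₁ : ∀ j x → h₁ x ≤ split₁ (fromℤ j) x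
  h₁≤split₁ j x = begin
    h₁ x            ≡⟨ h₁≡x-h₀ x ⟩
    x - h₀ x        ≤⟨ sub-antimono-≤ x (split₀≤h₀ j x) ⟩
    x - split₀ J x  ≡⟨ split₁≡x-split₀ J x ⟨
    split₁ J x      ∎
    where
    open ≤-Reasoning
    J = fromℤ j

  h₁≡split₁ : ∀ x → h₁ x ≡ split₁ (fromℤ ⌊ x /2⌋) x
  h₁≡split₁ x = begin
    h₁ x            ≡⟨ h₁≡x-h₀ x ⟩
    x - h₀ x        ≡⟨ cong (_-_ x) (h₀≡split₀ x) ⟩
    x - split₀ F x  ≡⟨ split₁≡x-split₀ F x ⟨
    split₁ F x      ∎
    where
    open ≡-Reasoning
    F = fromℤ ⌊ x /2⌋

  h₀-mono : Monotone h₀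
  h₀-mono {x} {y} x≤y = begin
    h₀ x                      ≡⟨ h₀≡split₀ x ⟩
    split₀ (fromℤ ⌊ x /2⌋) x  ≤⟨ split₀-mono _ x≤y ⟩
    split₀ (fromℤ ⌊ x /2⌋) y  ≤⟨ split₀≤h₀ ⌊ x /2⌋ y ⟩
    h₀ y                      ∎
    where open ≤-Reasoning

  h₁-mono : Monotone h₁
  h₁-mono {x} {y} x≤y = begin
    h₁ x                      ≤⟨ h₁≤split₁ ⌊ y /2⌋ x ⟩
    split₁ (fromℤ ⌊ y /2⌋) x  ≤⟨ split₁-mono _ x≤y ⟩
    split₁ (fromℤ ⌊ y /2⌋) y  ≡⟨ h₁≡split₁ y ⟨
    h₁ y                      ∎
    where open ≤-Reasoning

  h₀-nonneg : ∀ {x} → 0# ≤ x → 0# ≤ h₀ x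
  h₀-nonneg {x} 0≤x = ≤-trans (⊓-glb 0≤x-0 0≤0+1) (split₀≤h₀ (ℤ.+ 0) x)
    where
    0≤x-0 : 0# ≤ x - 0#
    0≤x-0 = subst (0# ≤_) (sym (x-0≡x x)) 0≤x
    0≤0+1 : 0# ≤ 0# + 1#
    0≤0+1 = subst (0# ≤_) (sym (+-identityˡ 1#)) 0≤1

  h₁-nonneg : ∀ {x} → 0# ≤ x → 0# ≤ h₁ x
  h₁-nonneg {x} 0≤x = subst (0# ≤_) (sym (h₁≡split₁ x)) (by-sign (fromℤ-sign ⌊ x /2⌋))
    where
    F = fromℤ ⌊ x /2⌋
    by-sign : 0# ≤ F ⊎ F + 1# ≤ 0# → 0# ≤ split₁ F x
    by-sign (inj₁ 0≤F)   = ≤-trans 0≤F (x≤x⊔y F (x - (F + 1#)))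
    by-sign (inj₂ F+1≤0) = ≤-trans 0≤x (≤-trans x≤x-[F+1] (x≤y⊔x F (x - (F + 1#))))
      where
      x≤x-[F+1] : x ≤ x - (F + 1#)
      x≤x-[F+1] = subst (_≤ x - (F + 1#)) (x-0≡x x) (sub-antimono-≤ x F+1≤0)

  -- Finite sums and the push-forward of mass

  Σ-cong : ∀ {g g′ : Fin n → R} → (∀ i → g i ≡ g′ i) → Σ[ g ] ≡ Σ[ g′ ]
  Σ-cong {n = ℕ.zero}  _     = refl
  Σ-cong {n = ℕ.suc n} g≗g′ = cong₂ _+_ (g≗g′ zero) (Σ-cong (g≗g′ ∘ suc))

  Σ-mono-≤ : ∀ {g g′ : Fin n → R} → (∀ i → g i ≤ g′ i) → Σ[ g ] ≤ Σ[ g′ ]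
  Σ-mono-≤ {n = ℕ.zero}  _     = ≤-refl
  Σ-mono-≤ {n = ℕ.suc n} g≤g′ = +-mono-≤ (g≤g′ zero) (Σ-mono-≤ (g≤g′ ∘ suc))

  Σ-zero : Σ[ (λ (_ : Fin n) → 0#) ] ≡ 0#
  Σ-zero {ℕ.zero}  = refl
  Σ-zero {ℕ.suc n} = trans (+-identityˡ _) (Σ-zero {n})

  Σ-distrib-+ : ∀ (g g′ : Fin n → R) → Σ[ (λ i → g i + g′ i) ] ≡ Σ[ g ] + Σ[ g′ ]
  Σ-distrib-+ {ℕ.zero}  g g′ = sym (+-identityʳ 0#)
  Σ-distrib-+ {ℕ.suc n} g g′ =
    trans (cong (g zero + g′ zero +_) (Σ-distrib-+ (g ∘ suc) (g′ ∘ suc))) (interchange _ _ _ _)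

  Σ-distrib-- : ∀ (g g′ : Fin n → R) → Σ[ (λ i → g i - g′ i) ] ≡ Σ[ g ] - Σ[ g′ ]
  Σ-distrib-- {ℕ.zero}  g g′ = sym (-‿inverseʳ 0#)
  Σ-distrib-- {ℕ.suc n} g g′ =
    trans (cong (g zero - g′ zero +_) (Σ-distrib-- (g ∘ suc) (g′ ∘ suc))) ([a-c]+[b-d]≡[a+b]-[c+d] _ _ _ _)

  Σ-comm : ∀ (G : Fin m → Fin n → R) → Σ[ (λ j → Σ[ (λ i → G i j) ]) ] ≡ Σ[ (λ i → Σ[ (λ j → G i j) ]) ]
  Σ-comm {m} {ℕ.zero}  G = sym (Σ-zero {m})
  Σ-comm {m} {ℕ.suc n} G = begin
    Σ[ (λ i → G i zero) ] + Σ[ (λ j → Σ[ (λ i → G i (suc j)) ]) ]  ≡⟨ cong (Σ[ (λ i → G i zero) ] +_) (Σ-comm (λ i j → G i (suc j))) ⟩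
    Σ[ (λ i → G i zero) ] + Σ[ (λ i → Σ[ (λ j → G i (suc j)) ]) ]  ≡⟨ Σ-distrib-+ (λ i → G i zero) (λ i → Σ[ (λ j → G i (suc j)) ]) ⟨
    Σ[ (λ i → G i zero + Σ[ (λ j → G i (suc j)) ]) ]               ∎
    where open ≡-Reasoning

  ∣Σ∣≤Σ∣∣ : ∀ (g : Fin n → R) → ∣ Σ[ g ] ∣ ≤ Σ[ (λ i → ∣ g i ∣) ]
  ∣Σ∣≤Σ∣∣ {ℕ.zero}  g = ≤-reflexive ∣0∣≡0
  ∣Σ∣≤Σ∣∣ {ℕ.suc n} g = ≤-trans (∣x+y∣≤∣x∣+∣y∣ _ _) (+-monoʳ-≤ _ (∣Σ∣≤Σ∣∣ (g ∘ suc)))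

  ‖x+y‖₁≤‖x‖₁+‖y‖₁ : ∀ (x y : Fin n → R) → ‖ (λ i → x i + y i) ‖₁ ≤ ‖ x ‖₁ + ‖ y ‖₁
  ‖x+y‖₁≤‖x‖₁+‖y‖₁ x y =
    ≤-trans (Σ-mono-≤ (λ i → ∣x+y∣≤∣x∣+∣y∣ (x i) (y i))) (≤-reflexive (Σ-distrib-+ (∣_∣ ∘ x) (∣_∣ ∘ y)))

  when-suc : ∀ (a b : Fin n) r → when (suc a) (suc b) r ≡ when a b r
  when-suc a b r with a ≟ b
  ... | yes _ = refl
  ... | no  _ = refl

  Σ-when : ∀ (a : Fin n) r → Σ[ (λ b → when a b r) ] ≡ r
  Σ-when {ℕ.suc n} zero r = trans (cong (r +_) (Σ-zero {n})) (+-identityʳ r)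
  Σ-when (suc a) r = trans (+-identityˡ _) (trans (Σ-cong (λ b → when-suc a b r)) (Σ-when a r))

  when-mono-≤ : ∀ (a b : Fin n) {r r′} → r ≤ r′ → when a b r ≤ when a b r′
  when-mono-≤ a b r≤r′ with a ≟ b
  ... | yes _ = r≤r′
  ... | no  _ = ≤-refl

  when-nonneg : ∀ (a b : Fin n) {r} → 0# ≤ r → 0# ≤ when a b r
  when-nonneg a b 0≤r with a ≟ b
  ... | yes _ = 0≤r
  ... | no  _ = ≤-refl

  when-- : ∀ (a b : Fin n) r r′ → when a b r - when a b r′ ≡ when a b (r - r′)
  when-- a b r r′ with a ≟ b
  ... | yes _ = refl
  ... | no  _ = -‿inverseʳ 0#

  ∣when∣ : ∀ (a b : Fin n) r → ∣ when a b r ∣ ≡ when a b ∣ r ∣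
  ∣when∣ a b r with a ≟ b
  ... | yes _ = refl
  ... | no  _ = ∣0∣≡0

  -- f s₀ s₁ x v is definitionally push s₀ (h₀ ∘ x) v + push s₁ (h₁ ∘ x) v.
  push : (Fin m → Fin n) → (Fin m → R) → Fin n → R
  push s g v = Σ[ (λ u → when (s u) v (g u)) ]

  push-nonneg : ∀ (s : Fin m → Fin n) {g} → (∀ u → 0# ≤ g u) → ∀ v → 0# ≤ push s g v
  push-nonneg {m} s 0≤g v =
    subst (_≤ push s _ v) (Σ-zero {m}) (Σ-mono-≤ (λ u → when-nonneg (s u) v (0≤g u)))

  push-mono-≤ : ∀ (s : Fin m → Fin n) {g g′} → (∀ u → g u ≤ g′ u) → ∀ v → push s g v ≤ push s g′ v
  push-mono-≤ s g≤g′ v = Σ-mono-≤ (λ u → when-mono-≤ (s u) v (g≤g′ u))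

  push-- : ∀ (s : Fin m → Fin n) g g′ v → push s g v - push s g′ v ≡ push s (λ u → g u - g′ u) v
  push-- s g g′ v = trans (sym (Σ-distrib-- (λ u → when (s u) v (g u)) (λ u → when (s u) v (g′ u))))
                          (Σ-cong (λ u → when-- (s u) v (g u) (g′ u)))

  Σ-push : ∀ (s : Fin m → Fin n) g → Σ[ push s g ] ≡ Σ[ g ]
  Σ-push s g = trans (Σ-comm (λ u v → when (s u) v (g u))) (Σ-cong (λ u → Σ-when (s u) (g u)))

  ‖push‖₁≤‖‖₁ : ∀ (s : Fin m → Fin n) g → ‖ push s g ‖₁ ≤ ‖ g ‖₁
  ‖push‖₁≤‖‖₁ s g = begin
    Σ[ (λ v → ∣ push s g v ∣) ]                             ≤⟨ Σ-mono-≤ (λ v → ∣Σ∣≤Σ∣∣ (λ u → when (s u) v (g u))) ⟩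
    Σ[ (λ v → Σ[ (λ u → ∣ when (s u) v (g u) ∣) ]) ]        ≡⟨ Σ-cong (λ v → Σ-cong (λ u → ∣when∣ (s u) v (g u))) ⟩
    Σ[ push s (∣_∣ ∘ g) ]                                   ≡⟨ Σ-push s (∣_∣ ∘ g) ⟩
    ‖ g ‖₁                                                  ∎
    where open ≤-Reasoning

  -- The one-step update

  f-nonneg : ∀ (s₀ s₁ : Fin n → Fin n) x → Nonneg x → Nonneg (f s₀ s₁ x)
  f-nonneg s₀ s₁ x 0≤x v = subst (_≤ f s₀ s₁ x v) (+-identityʳ 0#)
    (+-mono-≤ (push-nonneg s₀ (h₀-nonneg ∘ 0≤x) v) (push-nonneg s₁ (h₁-nonneg ∘ 0≤x) v))

  f-mono-≤ : ∀ (s₀ s₁ : Fin n → Fin n) {x y} → x ≤ᵛ y → f s₀ s₁ x ≤ᵛ f s₀ s₁ y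
  f-mono-≤ s₀ s₁ x≤y v = +-mono-≤ (push-mono-≤ s₀ (h₀-mono ∘ x≤y) v) (push-mono-≤ s₁ (h₁-mono ∘ x≤y) v)

  f-nonexpansive : ∀ (s₀ s₁ : Fin n → Fin n) x y → ‖ f s₀ s₁ x -ᵛ f s₀ s₁ y ‖₁ ≤ ‖ x -ᵛ y ‖₁
  f-nonexpansive {n} s₀ s₁ x y = begin
    ‖ f s₀ s₁ x -ᵛ f s₀ s₁ y ‖₁                ≡⟨ Σ-cong (λ v → cong ∣_∣ (f-difference v)) ⟩
    ‖ (λ v → push s₀ d₀ v + push s₁ d₁ v) ‖₁   ≤⟨ ‖x+y‖₁≤‖x‖₁+‖y‖₁ (push s₀ d₀) (push s₁ d₁) ⟩
    ‖ push s₀ d₀ ‖₁ + ‖ push s₁ d₁ ‖₁          ≤⟨ +-mono-≤ (‖push‖₁≤‖‖₁ s₀ d₀) (‖push‖₁≤‖‖₁ s₁ d₁) ⟩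
    ‖ d₀ ‖₁ + ‖ d₁ ‖₁                          ≡⟨ Σ-distrib-+ (∣_∣ ∘ d₀) (∣_∣ ∘ d₁) ⟨
    Σ[ (λ u → ∣ d₀ u ∣ + ∣ d₁ u ∣) ]            ≡⟨ Σ-cong (λ u → splitting-preserves-∣-∣ h₀-mono h₁-mono h₀+h₁≡id (x u) (y u)) ⟩
    ‖ x -ᵛ y ‖₁                                ∎
    where
    open ≤-Reasoning
    d₀ d₁ : Fin n → R
    d₀ u = h₀ (x u) - h₀ (y u)
    d₁ u = h₁ (x u) - h₁ (y u)
    f-difference : ∀ v → f s₀ s₁ x v - f s₀ s₁ y v ≡ push s₀ d₀ v + push s₁ d₁ v
    f-difference v = trans (sym ([a-c]+[b-d]≡[a+b]-[c+d] _ _ _ _))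
                           (cong₂ _+_ (push-- s₀ (h₀ ∘ x) (h₀ ∘ y) v) (push-- s₁ (h₁ ∘ x) (h₁ ∘ y) v))

mainTheorem6 : (ℝ : RealField) → let open RealOps ℝ in
    (n : ℕ) (s₀ s₁ : Fin n → Fin n) →
    (∀ x → Nonneg x → Nonneg (f s₀ s₁ x))
    × (∀ x y → Nonneg x → Nonneg y → x ≤ᵛ y → f s₀ s₁ x ≤ᵛ f s₀ s₁ y)
    × (∀ x y → Nonneg x → Nonneg y →
         ‖ f s₀ s₁ x -ᵛ f s₀ s₁ y ‖₁ ≤ ‖ x -ᵛ y ‖₁)
mainTheorem6 ℝ n s₀ s₁ =
  f-nonneg s₀ s₁ , (λ _ _ _ _ → f-mono-≤ s₀ s₁) , (λ x y _ _ → f-nonexpansive s₀ s₁ x y)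
  where open SwitchGraphUpdate ℝ
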